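{- Let $n$ be an odd perfect number, written in the form $n=\pi^\alpha M^2$, where $\pi$ is prime, $\alpha$ and $M$ are positive integers, $\gcd(\pi,M)=1$ and $\pi\equiv\alpha\equiv 1\pmod 4$. If $\alpha+2$ is prime, then $$\bigl(n\equiv(\alpha+2)^2\pmod{4(\alpha+2)^2}\bigr)\ \text{ or }\ \bigl(\pi\equiv 1\pmod{4(\alpha+2)}\bigr).$$
   Context: A positive integer $n$ is perfect if $\sigma(n)=2n$, where $\sigma(n)$ is the sum of the positive divisors of $n$. By Euler's theorem every odd perfect number $n$ has such a representation $n=\pi^\alpha M^2$; $\pi$ is the unique prime dividing $n$ to an odd power and $\alpha$ is its exponent. -}

module Defs where

open import Data.Nat using (ℕ; zero; suc; _+_; _*_)
open import Data.Nat.Divisibility using (_∣_; _∣?_)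
open import Data.Nat.DivMod using (_%_)
open import Relation.Nullary using (yes; no)
open import Relation.Binary.PropositionalEquality using (_≡_)

σ-upto : ℕ → ℕ → ℕ
σ-upto n zero = 0
σ-upto n (suc k) with suc k ∣? n
... | yes _ = suc k + σ-upto n k
... | no  _ = σ-upto n k

σ : ℕ → ℕ
σ n = σ-upto n n

Perfect : ℕ → Set
Perfect n = σ n ≡ 2 * n

-- congruence a ≡ b (mod m): m divides the (natural-number) difference |a - b|
open import Data.Nat using (_∸_)
open import Data.Product using (_×_)

_≡_[mod_] : ℕ → ℕ → ℕ → Set
a ≡ b [mod m ] = (m ∣ (a ∸ b)) × (m ∣ (b ∸ a))

-- Let q = α + 2. As q ≡ 3 and π ≡ 1 (mod 4), q ∤ π, so Fermat's little theorem gives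
-- q ∣ π ^ (α + 1) − 1 = (π − 1) σ(π ^ α). If q ∣ π − 1, then together with 4 ∣ π − 1 and q odd,
-- π ≡ 1 (mod 4q). Otherwise q ∣ σ(π ^ α), which divides σ(n) = 2n by multiplicativity of σ,
-- so q ∣ n and, as q ∤ π, q ∣ M. Writing M = w q gives n = π ^ α w² q², and π ^ α w² ≡ 1 (mod 4)
-- because π ≡ 1 (mod 4) and w is odd, so n ≡ q² (mod 4q²).

module Submission where

open import Level using (Level)
open import Data.Empty using (⊥-elim)
open import Data.Fin using (toℕ; fromℕ; inject₁)
import Data.Fin as Fin
open import Data.Fin.Properties using (toℕ-fromℕ; toℕ-inject₁; toℕ<n)
open import Data.Nat
  using (ℕ; zero; suc; _+_; _*_; _^_; _∸_; _!; _≤_; _<_; _≤′_; ≤′-refl; ≤′-step; z<s; s<s; s≤s; s≤s⁻¹;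
         NonZero; ≢-nonZero; >-nonZero⁻¹; nonTrivial⇒≢1)
open import Data.Nat.Combinatorics using (_C_; nCn≡1; nCk≡n!/k![n-k]!; k![n∸k]!∣n!)
open import Data.Nat.Coprimality using (Coprime; coprime-divisor; gcd≡1⇒coprime)
open import Data.Nat.Divisibility
  using (_∣_; _∤_; divides; _∣?_; _∣0; ∣-refl; ∣-trans; ∣1⇒≡1; ∣⇒≤; m∣m*n; ∣m⇒∣m*n; ∣n⇒∣m*n;
         ∣m∣n⇒∣m+n; *-monoʳ-∣; *-monoˡ-∣; *-cancelˡ-∣; ∣n∣m%n⇒∣m)
open import Data.Nat.DivMod
  using (_%_; _/_; m≡m%n+[m/n]*n; m/n*n≡m; m%n<n; %-congˡ; %-distribˡ-+; %-distribˡ-*; %-remove-+ʳ)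
open import Data.Nat.GCD using (gcd)
open import Data.Nat.Primality using (Prime; euclidsLemma; prime⇒irreducible; prime⇒nonZero; prime⇒nonTrivial)
open import Data.Nat.Properties
open import Data.Nat.Tactic.RingSolver using (solve-∀)
open import Algebra.Properties.CommutativeSemigroup +-commutativeSemigroup using (x∙yz≈y∙xz)
open import Algebra.Properties.CommutativeSemiring.Binomial +-*-commutativeSemiring
  using (binomialTerm) renaming (theorem to binomialTheorem)
open import Algebra.Properties.Semiring.Exp +-*-semiring using () renaming (_^_ to _^′_)
open import Algebra.Properties.Semiring.Mult +-*-semiring using () renaming (_×_ to _×′_)
open import Algebra.Properties.Semiring.Sum +-*-semiring using (sum; sum-init-last)
open import Data.Product using (_,_; proj₁)
open import Data.Sum using (_⊎_; inj₁; inj₂; [_,_]′; fromInj₁; fromInj₂)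
import Data.Sum as Sum
open import Data.Vec.Functional using (Vector; init; last; tail)
open import Function using (_∘_; id)
open import Relation.Binary.PropositionalEquality
  using (_≡_; _≢_; refl; sym; trans; cong; cong₂; subst; subst₂; module ≡-Reasoning)
open import Relation.Nullary using (¬_; Dec; yes; no; contradiction)
open import Relation.Unary using (Pred; Decidable; _≐_; _∩_; ∁)
open import Relation.Unary.Properties using (_∩?_; ∁?)

open import Defs

open ≡-Reasoning

private variable
  ℓ : Level
  P Q : Pred ℕ ℓ
  a b c d e k m n p w : ℕ

-- Congruences and remainders

%≡⇒∣∸ : .{{_ : NonZero d}} → m % d ≡ n % d → d ∣ m ∸ n
%≡⇒∣∸ {d} {m} {n} eq = divides (m / d ∸ n / d) (begin
  m ∸ n                                     ≡⟨ cong₂ _∸_ (m≡m%n+[m/n]*n m d) (m≡m%n+[m/n]*n n d) ⟩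
  (m % d + m / d * d) ∸ (n % d + n / d * d) ≡⟨ cong (λ r → (r + m / d * d) ∸ (n % d + n / d * d)) eq ⟩
  (n % d + m / d * d) ∸ (n % d + n / d * d) ≡⟨ [m+n]∸[m+o]≡n∸o (n % d) (m / d * d) (n / d * d) ⟩
  m / d * d ∸ n / d * d                     ≡⟨ *-distribʳ-∸ d (m / d) (n / d) ⟨
  (m / d ∸ n / d) * d                       ∎)

∣∸⇒%≡ : .{{_ : NonZero d}} → n ≤ m → d ∣ m ∸ n → m % d ≡ n % d
∣∸⇒%≡ {d} {n} {m} n≤m d∣m∸n = begin
  m % d             ≡⟨ %-congˡ (m+[n∸m]≡n n≤m) ⟨
  (n + (m ∸ n)) % d ≡⟨ %-remove-+ʳ n d∣m∸n ⟩
  n % d             ∎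

%≡⇒≡[mod] : ∀ m n .{{_ : NonZero d}} → m % d ≡ n % d → m ≡ n [mod d ]
%≡⇒≡[mod] m n eq = %≡⇒∣∸ eq , %≡⇒∣∸ (sym eq)

≡[mod]⇒%≡ : ∀ m n .{{_ : NonZero d}} → m ≡ n [mod d ] → m % d ≡ n % d
≡[mod]⇒%≡ m n (d∣m∸n , d∣n∸m) with ≤-total n m
... | inj₁ n≤m = ∣∸⇒%≡ n≤m d∣m∸n
... | inj₂ m≤n = sym (∣∸⇒%≡ m≤n d∣n∸m)

∣∸⇒≡[mod] : ∀ m n → n ≤ m → d ∣ m ∸ n → m ≡ n [mod d ]
∣∸⇒≡[mod] {d} m n n≤m d∣m∸n = d∣m∸n , subst (d ∣_) (sym (m≤n⇒m∸n≡0 n≤m)) (d ∣0)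

≡[mod]-*ʳ : ∀ m n c → m ≡ n [mod d ] → (m * c) ≡ n * c [mod d * c ]
≡[mod]-*ʳ {d} m n c (d∣m∸n , d∣n∸m) =
  subst (d * c ∣_) (*-distribʳ-∸ c m n) (*-monoˡ-∣ c d∣m∸n) ,
  subst (d * c ∣_) (*-distribʳ-∸ c n m) (*-monoˡ-∣ c d∣n∸m)

coprime⇒*∣ : Coprime d e → d ∣ m → e ∣ m → d * e ∣ m
coprime⇒*∣ {d = d} {e = e} coprime d∣qe (divides q refl)
  with coprime-divisor coprime (subst (d ∣_) (*-comm q e) d∣qe)
... | divides r refl = divides r (*-assoc r d e)

≡[mod]-coprime-* : ∀ m n → Coprime d e → m ≡ n [mod d ] → m ≡ n [mod e ] → m ≡ n [mod d * e ]
≡[mod]-coprime-* m n coprime (d∣m∸n , d∣n∸m) (e∣m∸n , e∣n∸m) =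
  coprime⇒*∣ coprime d∣m∸n e∣m∸n , coprime⇒*∣ coprime d∣n∸m e∣n∸m

≡[mod]-cancelˡ : ∀ m n → Prime p → p ∤ a → (a * m) ≡ a * n [mod p ] → m ≡ n [mod p ]
≡[mod]-cancelˡ {p} {a} m n p-prime p∤a (p∣am∸an , p∣an∸am) = cancel m n p∣am∸an , cancel n m p∣an∸am
  where
  cancel : ∀ x y → p ∣ a * x ∸ a * y → p ∣ x ∸ y
  cancel x y p∣ax∸ay = fromInj₂ (⊥-elim ∘ p∤a)
    (euclidsLemma a (x ∸ y) p-prime (subst (p ∣_) (sym (*-distribˡ-∸ a x y)) p∣ax∸ay))

%-cong-* : .{{_ : NonZero d}} → a % d ≡ b % d → c % d ≡ e % d → a * c % d ≡ b * e % d
%-cong-* {d} {a} {b} {c} {e} a≡b c≡e = begin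
  a * c % d             ≡⟨ %-distribˡ-* a c d ⟩
  (a % d) * (c % d) % d ≡⟨ cong₂ (λ x y → x * y % d) a≡b c≡e ⟩
  (b % d) * (e % d) % d ≡⟨ %-distribˡ-* b e d ⟨
  b * e % d             ∎

%-cong-^ : .{{_ : NonZero d}} → a % d ≡ b % d → ∀ k → a ^ k % d ≡ b ^ k % d
%-cong-^ a≡b zero    = refl
%-cong-^ a≡b (suc k) = %-cong-* a≡b (%-cong-^ a≡b k)

odd⇒square%4≡1 : 2 ∤ w → w * w % 4 ≡ 1
odd⇒square%4≡1 {w} 2∤w = trans (%-distribˡ-* w w 4) (square-of-residue (w % 4) (m%n<n w 4) refl)
  where
  2∤w%4 : 2 ∤ w % 4
  2∤w%4 = 2∤w ∘ ∣n∣m%n⇒∣m (divides 2 refl)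
  square-of-residue : ∀ r → r < 4 → w % 4 ≡ r → r * r % 4 ≡ 1
  square-of-residue 0 _ w%4≡0 = contradiction (subst (2 ∣_) (sym w%4≡0) (2 ∣0)) 2∤w%4
  square-of-residue 1 _ _ = refl
  square-of-residue 2 _ w%4≡2 = contradiction (subst (2 ∣_) (sym w%4≡2) ∣-refl) 2∤w%4
  square-of-residue 3 _ _ = refl
  square-of-residue (suc (suc (suc (suc _)))) (s≤s (s≤s (s≤s (s≤s ())))) _

-- Primes

prime≢1 : Prime p → p ≢ 1
prime≢1 p-prime = nonTrivial⇒≢1 {{prime⇒nonTrivial p-prime}}

prime∤1 : Prime p → p ∤ 1
prime∤1 p-prime = prime≢1 p-prime ∘ ∣1⇒≡1

prime∤⇒coprime : Prime p → p ∤ n → Coprime n p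
prime∤⇒coprime p-prime p∤n (i∣n , i∣p) with prime⇒irreducible p-prime i∣p
... | inj₁ i≡1 = i≡1
... | inj₂ refl = contradiction i∣n p∤n

coprime⇒prime∤ : Prime p → Coprime p n → p ∤ n
coprime⇒prime∤ p-prime coprime p∣n = prime≢1 p-prime (coprime (∣-refl , p∣n))

prime∣^⇒∣ : Prime p → ∀ k → p ∣ m ^ k → p ∣ m
prime∣^⇒∣ p-prime zero p∣1 = contradiction p∣1 (prime∤1 p-prime)
prime∣^⇒∣ {m = m} p-prime (suc k) p∣m^[1+k] =
  [ id , prime∣^⇒∣ p-prime k ]′ (euclidsLemma m (m ^ k) p-prime p∣m^[1+k])

prime∤! : Prime p → k < p → p ∤ k !
prime∤! {k = zero} p-prime _ = prime∤1 p-prime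
prime∤! {k = suc k} p-prime k<p p∣[1+k]! with euclidsLemma (suc k) (k !) p-prime p∣[1+k]!
... | inj₁ p∣1+k = <⇒≱ k<p (∣⇒≤ p∣1+k)
... | inj₂ p∣k! = prime∤! p-prime (<-trans (n<1+n k) k<p) p∣k!

prime∣C : Prime p → 0 < k → k < p → p ∣ p C k
prime∣C {p@(suc q)} {k} p-prime 0<k k<p = fromInj₁ (⊥-elim ∘ p∤k![p∸k]!)
  (euclidsLemma (p C k) (k ! * (p ∸ k) !) p-prime (subst (p ∣_) (sym C*k![p∸k]!≡p!) (m∣m*n (q !))))
  where
  instance _ = k !* (p ∸ k) !≢0
  C*k![p∸k]!≡p! : (p C k) * (k ! * (p ∸ k) !) ≡ p !
  C*k![p∸k]!≡p! = trans (cong (_* (k ! * (p ∸ k) !)) (nCk≡n!/k![n-k]! (<⇒≤ k<p)))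
                        (m/n*n≡m (k![n∸k]!∣n! (<⇒≤ k<p)))
  p∤k![p∸k]! : p ∤ k ! * (p ∸ k) !
  p∤k![p∸k]! = [ prime∤! p-prime k<p , prime∤! p-prime (∸-monoʳ-< 0<k (<⇒≤ k<p)) ]′
             ∘ euclidsLemma (k !) ((p ∸ k) !) p-prime

-- Fermat's little theorem

-- The library's binomial theorem uses the semiring's own power and multiple, which agree
-- with those of ℕ only propositionally.
^′≡^ : ∀ x k → x ^′ k ≡ x ^ k
^′≡^ x zero    = refl
^′≡^ x (suc k) = cong (x *_) (^′≡^ x k)

×′≡* : ∀ k x → k ×′ x ≡ k * x
×′≡* zero    x = refl
×′≡* (suc k) x = cong (x +_) (×′≡* k x)

∣-sum : (f : Vector ℕ n) → (∀ i → d ∣ f i) → d ∣ sum f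
∣-sum {zero}  f d∣f = _ ∣0
∣-sum {suc n} f d∣f = ∣m∣n⇒∣m+n (d∣f Fin.zero) (∣-sum (tail f) (d∣f ∘ Fin.suc))

freshmansDream : .{{_ : NonZero p}} → ∀ a → Prime p → suc a ^ p % p ≡ suc (a ^ p) % p
freshmansDream {p@(suc q)} a p-prime = begin
  suc a ^ p % p
    ≡⟨ %-congˡ (trans (sym (^′≡^ (1 + a) p)) (binomialTheorem p 1 a)) ⟩
  (t Fin.zero + sum (tail t)) % p
    ≡⟨ %-congˡ (cong₂ _+_ first (sum-init-last (tail t))) ⟩
  (a ^ p + (sum (init (tail t)) + last (tail t))) % p
    ≡⟨ %-congˡ (cong (λ x → a ^ p + (sum (init (tail t)) + x)) final) ⟩
  (a ^ p + (sum (init (tail t)) + 1)) % p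
    ≡⟨ %-congˡ (trans (cong (a ^ p +_) (+-comm _ 1)) (+-suc (a ^ p) _)) ⟩
  (suc (a ^ p) + sum (init (tail t))) % p
    ≡⟨ %-remove-+ʳ (suc (a ^ p)) (∣-sum (init (tail t)) middle) ⟩
  suc (a ^ p) % p ∎
  where
  t = binomialTerm 1 a p
  term : ∀ k → t k ≡ (p C toℕ k) * a ^ (p ∸ toℕ k)
  term k = trans (×′≡* (p C toℕ k) _) (cong ((p C toℕ k) *_) (begin
    1 ^′ toℕ k * a ^′ (p ∸ toℕ k) ≡⟨ cong₂ _*_ (trans (^′≡^ 1 (toℕ k)) (^-zeroˡ (toℕ k))) (^′≡^ a (p ∸ toℕ k)) ⟩
    1 * a ^ (p ∸ toℕ k)           ≡⟨ *-identityˡ (a ^ (p ∸ toℕ k)) ⟩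
    a ^ (p ∸ toℕ k)               ∎))
  first : t Fin.zero ≡ a ^ p
  first = trans (term Fin.zero) (*-identityˡ (a ^ p))
  final : last (tail t) ≡ 1
  final = begin
    t (Fin.suc (fromℕ q))                                   ≡⟨ term (Fin.suc (fromℕ q)) ⟩
    (p C suc (toℕ (fromℕ q))) * a ^ (q ∸ toℕ (fromℕ q)) ≡⟨ cong (λ j → (p C suc j) * a ^ (q ∸ j)) (toℕ-fromℕ q) ⟩
    (p C p) * a ^ (q ∸ q)                               ≡⟨ cong₂ (λ c e → c * a ^ e) (nCn≡1 p) (n∸n≡0 q) ⟩
    1                                                   ∎
  middle : ∀ i → p ∣ init (tail t) i
  middle i = subst (p ∣_) (sym (term (Fin.suc (inject₁ i))))
    (∣m⇒∣m*n _ (prime∣C p-prime z<s (s<s (subst (_< q) (sym (toℕ-inject₁ i)) (toℕ<n i)))))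

fermat-% : .{{_ : NonZero p}} → Prime p → ∀ a → a ^ p % p ≡ a % p
fermat-% {suc q} p-prime zero = refl
fermat-% {p} p-prime (suc a) = begin
  suc a ^ p % p             ≡⟨ freshmansDream a p-prime ⟩
  (1 + a ^ p) % p           ≡⟨ %-distribˡ-+ 1 (a ^ p) p ⟩
  (1 % p + a ^ p % p) % p   ≡⟨ cong (λ x → (1 % p + x) % p) (fermat-% p-prime a) ⟩
  (1 % p + a % p) % p       ≡⟨ %-distribˡ-+ 1 a p ⟨
  suc a % p                 ∎

fermat : .{{_ : NonZero p}} → Prime p → p ∤ a → (a ^ (p ∸ 1)) ≡ 1 [mod p ]
fermat {p@(suc q)} {a} p-prime p∤a = ≡[mod]-cancelˡ (a ^ q) 1 p-prime p∤a
  (%≡⇒≡[mod] (a ^ p) (a * 1) (trans (fermat-% p-prime a) (cong (_% p) (sym (*-identityʳ a)))))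

-- Divisor sums

sumWhere : Decidable P → ℕ → ℕ
sumWhere P? zero = 0
sumWhere P? (suc k) with P? (suc k)
... | yes _ = suc k + sumWhere P? k
... | no  _ = sumWhere P? k

σ-upto≡sumWhere : ∀ n k → σ-upto n k ≡ sumWhere (_∣? n) k
σ-upto≡sumWhere n zero = refl
σ-upto≡sumWhere n (suc k) with suc k ∣? n
... | yes _ = cong (suc k +_) (σ-upto≡sumWhere n k)
... | no  _ = σ-upto≡sumWhere n k

sumWhere-yes : ∀ (P? : Decidable P) {k} → P (suc k) → sumWhere P? (suc k) ≡ suc k + sumWhere P? k
sumWhere-yes P? {k} p with P? (suc k)
... | yes _ = refl
... | no ¬p = contradiction p ¬p

sumWhere-no : ∀ (P? : Decidable P) {k} → ¬ P (suc k) → sumWhere P? (suc k) ≡ sumWhere P? k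
sumWhere-no P? {k} ¬p with P? (suc k)
... | yes p = contradiction p ¬p
... | no _  = refl

sumWhere-cong : (P? : Decidable P) (Q? : Decidable Q) → P ≐ Q → ∀ k → sumWhere P? k ≡ sumWhere Q? k
sumWhere-cong P? Q? P≐Q zero = refl
sumWhere-cong P? Q? P≐Q@(P⊆Q , Q⊆P) (suc k) with P? (suc k)
... | yes p = begin
  suc k + sumWhere P? k ≡⟨ cong (suc k +_) (sumWhere-cong P? Q? P≐Q k) ⟩
  suc k + sumWhere Q? k ≡⟨ sumWhere-yes Q? (P⊆Q p) ⟨
  sumWhere Q? (suc k) ∎
... | no ¬p = begin
  sumWhere P? k ≡⟨ sumWhere-cong P? Q? P≐Q k ⟩
  sumWhere Q? k ≡⟨ sumWhere-no Q? (¬p ∘ Q⊆P) ⟨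
  sumWhere Q? (suc k) ∎

sumWhere-split : (P? : Decidable P) (Q? : Decidable Q) →
  ∀ k → sumWhere P? k ≡ sumWhere (P? ∩? Q?) k + sumWhere (P? ∩? ∁? Q?) k
sumWhere-split P? Q? zero = refl
sumWhere-split {P = P} {Q = Q} P? Q? (suc k) = split-at (P? (suc k)) (Q? (suc k))
  where
  A = sumWhere (P? ∩? Q?) k
  B = sumWhere (P? ∩? ∁? Q?) k
  PQ[1+k] = sumWhere (P? ∩? Q?) (suc k)
  P¬Q[1+k] = sumWhere (P? ∩? ∁? Q?) (suc k)
  split-at : Dec (P (suc k)) → Dec (Q (suc k)) → sumWhere P? (suc k) ≡ PQ[1+k] + P¬Q[1+k]
  split-at (yes p) (yes q) = begin
    sumWhere P? (suc k) ≡⟨ sumWhere-yes P? p ⟩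
    suc k + sumWhere P? k ≡⟨ cong (suc k +_) (sumWhere-split P? Q? k) ⟩
    suc k + (A + B) ≡⟨ +-assoc (suc k) A B ⟨
    suc k + A + B ≡⟨ cong₂ _+_ (sumWhere-yes (P? ∩? Q?) (p , q)) (sumWhere-no (P? ∩? ∁? Q?) (λ (_ , ¬q) → ¬q q)) ⟨
    PQ[1+k] + P¬Q[1+k] ∎
  split-at (yes p) (no ¬q) = begin
    sumWhere P? (suc k) ≡⟨ sumWhere-yes P? p ⟩
    suc k + sumWhere P? k ≡⟨ cong (suc k +_) (sumWhere-split P? Q? k) ⟩
    suc k + (A + B) ≡⟨ x∙yz≈y∙xz (suc k) A B ⟩
    A + (suc k + B) ≡⟨ cong₂ _+_ (sumWhere-no (P? ∩? Q?) (λ (_ , q) → ¬q q)) (sumWhere-yes (P? ∩? ∁? Q?) (p , ¬q)) ⟨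
    PQ[1+k] + P¬Q[1+k] ∎
  split-at (no ¬p) _ = begin
    sumWhere P? (suc k) ≡⟨ sumWhere-no P? ¬p ⟩
    sumWhere P? k ≡⟨ sumWhere-split P? Q? k ⟩
    A + B ≡⟨ cong₂ _+_ (sumWhere-no (P? ∩? Q?) (¬p ∘ proj₁)) (sumWhere-no (P? ∩? ∁? Q?) (¬p ∘ proj₁)) ⟨
    PQ[1+k] + P¬Q[1+k] ∎

sumWhere-beyond : (P? : Decidable P) → ∀ {k K} → k ≤ K → (∀ {d} → k < d → d ≤ K → ¬ P d) →
  sumWhere P? K ≡ sumWhere P? k
sumWhere-beyond {P = P} P? k≤K none = go (≤⇒≤′ k≤K) none
  where
  go : ∀ {k K} → k ≤′ K → (∀ {d} → k < d → d ≤ K → ¬ P d) → sumWhere P? K ≡ sumWhere P? k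
  go ≤′-refl _ = refl
  go (≤′-step k≤′K) none = trans (sumWhere-no P? (none (s≤s (≤′⇒≤ k≤′K)) ≤-refl))
                                 (go k≤′K (λ k<d d≤K → none k<d (m≤n⇒m≤1+n d≤K)))

∤-between-multiples : ∀ m {k d} → m * k < d → d < m * suc k → ¬ m ∣ d
∤-between-multiples m {k} {d} mk<d d<m[1+k] (divides q refl) =
  <⇒≱ (*-cancelˡ-< m k q (subst (m * k <_) (*-comm q m) mk<d))
      (s≤s⁻¹ (*-cancelˡ-< m q (suc k) (subst (_< m * suc k) (*-comm q m) d<m[1+k])))

sumWhere-multiples : (P? : Decidable P) (m : ℕ) .{{_ : NonZero m}} → ∀ k →
  sumWhere (P? ∩? (m ∣?_)) (m * k) ≡ m * sumWhere (P? ∘ (m *_)) k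
sumWhere-multiples P? m zero rewrite *-zeroʳ m = refl
sumWhere-multiples {P = P} P? m@(suc r) (suc k) = step (P? (m * suc k))
  where
  S = sumWhere (P? ∩? (m ∣?_))
  T = sumWhere (P? ∘ (m *_))
  top : m * suc k ≡ suc (r + m * k)
  top = *-suc m k
  below : S (r + m * k) ≡ m * T k
  below = trans (sumWhere-beyond (P? ∩? (m ∣?_)) (m≤n+m (m * k) r)
                   (λ {d} mk<d d≤r+mk (_ , m∣d) → ∤-between-multiples m mk<d (subst (d <_) (sym top) (s≤s d≤r+mk)) m∣d))
                (sumWhere-multiples P? m k)
  m∣top : m ∣ suc (r + m * k)
  m∣top = divides (suc k) (trans (sym top) (*-comm m (suc k)))
  step : Dec (P (m * suc k)) → S (m * suc k) ≡ m * T (suc k)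
  step (yes p) = begin
    S (m * suc k)              ≡⟨ cong S top ⟩
    S (suc (r + m * k))        ≡⟨ sumWhere-yes (P? ∩? (m ∣?_)) (subst P top p , m∣top) ⟩
    suc (r + m * k) + S (r + m * k) ≡⟨ cong₂ _+_ (sym top) below ⟩
    m * suc k + m * T k        ≡⟨ *-distribˡ-+ m (suc k) (T k) ⟨
    m * (suc k + T k)          ≡⟨ cong (m *_) (sumWhere-yes (P? ∘ (m *_)) p) ⟨
    m * T (suc k) ∎
  step (no ¬p) = begin
    S (m * suc k)              ≡⟨ cong S top ⟩
    S (suc (r + m * k))        ≡⟨ sumWhere-no (P? ∩? (m ∣?_)) (λ (p , _) → ¬p (subst P (sym top) p)) ⟩
    S (r + m * k)              ≡⟨ below ⟩
    m * T k                    ≡⟨ cong (m *_) (sumWhere-no (P? ∘ (m *_)) ¬p) ⟨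
    m * T (suc k) ∎

coprime-divisor-^ : Coprime d p → ∀ k → d ∣ p ^ k * m → d ∣ m
coprime-divisor-^ {d} {m = m} coprime zero d∣1*m = subst (d ∣_) (*-identityˡ m) d∣1*m
coprime-divisor-^ {d} {p} {m} coprime (suc k) d∣p^[1+k]*m =
  coprime-divisor-^ coprime k (coprime-divisor coprime (subst (d ∣_) (*-assoc p (p ^ k) m) d∣p^[1+k]*m))

-- A divisor of p * N is either a multiple of p, i.e. p times a divisor of N,
-- or prime to p and then a divisor of m.
σ[p*p^k*m] : Prime p → p ∤ m → ∀ k → σ (p * (p ^ k * m)) ≡ p * σ (p ^ k * m) + σ m
σ[p*p^k*m] {p} {m} p-prime p∤m k = begin
  σ (p * N)                                                        ≡⟨ σ-upto≡sumWhere (p * N) (p * N) ⟩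
  sumWhere (_∣? (p * N)) (p * N)                                   ≡⟨ sumWhere-split (_∣? (p * N)) (p ∣?_) (p * N) ⟩
  sumWhere ((_∣? (p * N)) ∩? (p ∣?_)) (p * N)
    + sumWhere ((_∣? (p * N)) ∩? ∁? (p ∣?_)) (p * N)                ≡⟨ cong₂ _+_ multiples-of-p coprime-to-p ⟩
  p * σ N + σ m                                                    ∎
  where
  N = p ^ k * m
  instance
    _ = prime⇒nonZero p-prime
    _ = ≢-nonZero (λ { refl → p∤m (p ∣0) })
    _ = m^n≢0 p k
  multiples-of-p : sumWhere ((_∣? (p * N)) ∩? (p ∣?_)) (p * N) ≡ p * σ N
  multiples-of-p = begin
    sumWhere ((_∣? (p * N)) ∩? (p ∣?_)) (p * N)   ≡⟨ sumWhere-multiples (_∣? (p * N)) p N ⟩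
    p * sumWhere ((_∣? (p * N)) ∘ (p *_)) N     ≡⟨ cong (p *_) (sumWhere-cong _ (_∣? N) (*-cancelˡ-∣ p , *-monoʳ-∣ p) N) ⟩
    p * sumWhere (_∣? N) N                      ≡⟨ cong (p *_) (σ-upto≡sumWhere N N) ⟨
    p * σ N                                     ∎
  m≤p*N : m ≤ p * N
  m≤p*N = ≤-trans (m≤n*m m (p ^ k)) (m≤n*m N p)
  divisors-prime-to-p : (_∣ p * N) ∩ ∁ (p ∣_) ≐ (_∣ m)
  divisors-prime-to-p =
    (λ {d} (d∣pN , p∤d) → coprime-divisor-^ (prime∤⇒coprime p-prime p∤d) (suc k)
                            (subst (d ∣_) (sym (*-assoc p (p ^ k) m)) d∣pN)) ,
    (λ d∣m → ∣n⇒∣m*n p (∣n⇒∣m*n (p ^ k) d∣m) , λ p∣d → p∤m (∣-trans p∣d d∣m))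
  coprime-to-p : sumWhere ((_∣? (p * N)) ∩? ∁? (p ∣?_)) (p * N) ≡ σ m
  coprime-to-p = begin
    sumWhere ((_∣? (p * N)) ∩? ∁? (p ∣?_)) (p * N)
      ≡⟨ sumWhere-cong _ (_∣? m) divisors-prime-to-p (p * N) ⟩
    sumWhere (_∣? m) (p * N)
      ≡⟨ sumWhere-beyond (_∣? m) m≤p*N (λ m<d _ d∣m → <⇒≱ m<d (∣⇒≤ d∣m)) ⟩
    sumWhere (_∣? m) m                           ≡⟨ σ-upto≡sumWhere m m ⟨
    σ m                                          ∎

σ[p^[1+k]] : Prime p → ∀ k → σ (p ^ suc k) ≡ p * σ (p ^ k) + 1
σ[p^[1+k]] {p} p-prime k = begin
  σ (p ^ suc k)              ≡⟨ cong (σ ∘ (p *_)) (*-identityʳ (p ^ k)) ⟨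
  σ (p * (p ^ k * 1))        ≡⟨ σ[p*p^k*m] p-prime (prime∤1 p-prime) k ⟩
  p * σ (p ^ k * 1) + σ 1    ≡⟨ cong (λ x → p * σ x + 1) (*-identityʳ (p ^ k)) ⟩
  p * σ (p ^ k) + 1          ∎

σ[p^k*m] : Prime p → p ∤ m → ∀ k → σ (p ^ k * m) ≡ σ (p ^ k) * σ m
σ[p^k*m] {m = m} p-prime p∤m zero = trans (cong σ (*-identityˡ m)) (sym (*-identityˡ (σ m)))
σ[p^k*m] {p} {m} p-prime p∤m (suc k) = begin
  σ (p ^ suc k * m)                   ≡⟨ cong σ (*-assoc p (p ^ k) m) ⟩
  σ (p * (p ^ k * m))                 ≡⟨ σ[p*p^k*m] p-prime p∤m k ⟩
  p * σ (p ^ k * m) + σ m             ≡⟨ cong (λ x → p * x + σ m) (σ[p^k*m] p-prime p∤m k) ⟩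
  p * (σ (p ^ k) * σ m) + σ m         ≡⟨ factor p (σ (p ^ k)) (σ m) ⟩
  (p * σ (p ^ k) + 1) * σ m           ≡⟨ cong (_* σ m) (σ[p^[1+k]] p-prime k) ⟨
  σ (p ^ suc k) * σ m                 ∎
  where
  factor : ∀ x y z → x * (y * z) + z ≡ (x * y + 1) * z
  factor = solve-∀

p^[1+k]≡1+[p∸1]*σ[p^k] : Prime p → ∀ k → p ^ suc k ≡ 1 + (p ∸ 1) * σ (p ^ k)
p^[1+k]≡1+[p∸1]*σ[p^k] {suc r} p-prime zero = refl
p^[1+k]≡1+[p∸1]*σ[p^k] {p@(suc r)} p-prime (suc k) = begin
  p * p ^ suc k                   ≡⟨ cong (p *_) (p^[1+k]≡1+[p∸1]*σ[p^k] p-prime k) ⟩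
  p * (1 + r * σ (p ^ k))         ≡⟨ geometric-step r (σ (p ^ k)) ⟩
  1 + r * (p * σ (p ^ k) + 1)     ≡⟨ cong (λ x → 1 + r * x) (σ[p^[1+k]] p-prime k) ⟨
  1 + r * σ (p ^ suc k)           ∎
  where
  geometric-step : ∀ r s → suc r * (1 + r * s) ≡ 1 + r * (suc r * s + 1)
  geometric-step = solve-∀

-- Odd perfect numbers π ^ α * M²

α≡1⇒α+2∤π : ∀ {π α} → π % 4 ≡ 1 → α % 4 ≡ 1 → Prime π → α + 2 ∤ π
α≡1⇒α+2∤π {π} {α} π%4≡1 α%4≡1 π-prime α+2∣π = 3≢1 (begin
  3               ≡⟨ cong (λ r → (r + 2) % 4) α%4≡1 ⟨
  (α % 4 + 2) % 4 ≡⟨ %-distribˡ-+ α 2 4 ⟨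
  (α + 2) % 4     ≡⟨ [ cong (_% 4) , (λ α+2≡π → trans (cong (_% 4) α+2≡π) π%4≡1) ]′ (prime⇒irreducible π-prime α+2∣π) ⟩
  1               ∎)
  where
  3≢1 : 3 ≢ 1
  3≢1 ()

π^α*M²≡q²[mod4q²] : ∀ {n} π α {M q} → 2 ∤ n → n ≡ π ^ α * (M * M) → π % 4 ≡ 1 → q ∣ M →
  n ≡ q * q [mod 4 * (q * q) ]
π^α*M²≡q²[mod4q²] {n} π α {M} {q} 2∤n n≡π^α*M² π%4≡1 (divides w refl) =
  subst₂ (λ x y → x ≡ y [mod 4 * (q * q) ]) (sym n≡t*q²) (*-identityˡ (q * q)) (≡[mod]-*ʳ t 1 (q * q) t≡1)
  where
  t = π ^ α * (w * w)
  n≡t*q² : n ≡ t * (q * q)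
  n≡t*q² = trans n≡π^α*M² (rearrange (π ^ α) w q)
    where
    rearrange : ∀ x w p → x * (w * p * (w * p)) ≡ x * (w * w) * (p * p)
    rearrange = solve-∀
  2∤w : 2 ∤ w
  2∤w 2∣w = 2∤n (subst (2 ∣_) (sym n≡π^α*M²) (∣n⇒∣m*n (π ^ α) (∣m⇒∣m*n (w * q) (∣m⇒∣m*n q 2∣w))))
  t≡1 : t ≡ 1 [mod 4 ]
  t≡1 = %≡⇒≡[mod] t 1 (%-cong-* {a = π ^ α} {b = 1} {c = w * w} {e = 1}
    (trans (%-cong-^ {a = π} {b = 1} π%4≡1 α) (cong (_% 4) (^-zeroˡ α))) (odd⇒square%4≡1 2∤w))

q∣σ[π^α]⇒q∣M : ∀ {n} π α {M q} → Perfect n → n ≡ π ^ α * (M * M) → Prime π → π ∤ M →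
  Prime q → q ∤ 2 → q ∤ π → q ∣ σ (π ^ α) → q ∣ M
q∣σ[π^α]⇒q∣M {n} π α {M} {q} perfect n≡π^α*M² π-prime π∤M q-prime q∤2 q∤π q∣σ[π^α] =
  [ (λ q∣π^α → contradiction (prime∣^⇒∣ q-prime α q∣π^α) q∤π) , [ id , id ]′ ∘ euclidsLemma M M q-prime ]′
    (euclidsLemma (π ^ α) (M * M) q-prime (subst (q ∣_) n≡π^α*M² q∣n))
  where
  σ[n]≡σ[π^α]*σ[M²] : σ n ≡ σ (π ^ α) * σ (M * M)
  σ[n]≡σ[π^α]*σ[M²] = trans (cong σ n≡π^α*M²) (σ[p^k*m] π-prime ([ π∤M , π∤M ]′ ∘ euclidsLemma M M π-prime) α)
  q∣n : q ∣ n
  q∣n = fromInj₂ (⊥-elim ∘ q∤2) (euclidsLemma 2 n q-prime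
          (subst (q ∣_) (trans (sym σ[n]≡σ[π^α]*σ[M²]) perfect) (∣m⇒∣m*n (σ (M * M)) q∣σ[π^α])))

theorem2 : (n π α M : ℕ) → 0 < n → Perfect n → ¬ (2 ∣ n) →
    n ≡ π ^ α * (M * M) → Prime π → 0 < α → 0 < M → gcd π M ≡ 1 →
    π ≡ 1 [mod 4 ] → α ≡ 1 [mod 4 ] → Prime (α + 2) →
    (n ≡ (α + 2) * (α + 2) [mod 4 * ((α + 2) * (α + 2)) ])
    ⊎ (π ≡ 1 [mod 4 * (α + 2) ])
theorem2 n π α M _ perfect 2∤n n≡π^α*M² π-prime 0<α _ gcd[π,M]≡1 π≡1 α≡1 q-prime =
  Sum.map q∣σ[π^α]⇒n≡q² q∣π∸1⇒π≡1 (euclidsLemma (σ (π ^ α)) (π ∸ 1) q-prime q∣σ[π^α]*[π∸1])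
  where
  q = α + 2
  instance _ = prime⇒nonZero q-prime
  q∤π : q ∤ π
  q∤π = α≡1⇒α+2∤π (≡[mod]⇒%≡ π 1 π≡1) (≡[mod]⇒%≡ α 1 α≡1) π-prime
  q∤2 : q ∤ 2
  q∤2 q∣2 = <⇒≱ (+-monoˡ-< 2 0<α) (∣⇒≤ q∣2)
  q∣σ[π^α]*[π∸1] : q ∣ σ (π ^ α) * (π ∸ 1)
  q∣σ[π^α]*[π∸1] = subst (q ∣_) (begin
    π ^ (q ∸ 1) ∸ 1           ≡⟨ cong (λ k → π ^ (k ∸ 1) ∸ 1) (+-comm α 2) ⟩
    π ^ suc α ∸ 1             ≡⟨ cong (_∸ 1) (p^[1+k]≡1+[p∸1]*σ[p^k] π-prime α) ⟩
    (π ∸ 1) * σ (π ^ α)       ≡⟨ *-comm (π ∸ 1) (σ (π ^ α)) ⟩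
    σ (π ^ α) * (π ∸ 1)       ∎) (proj₁ (fermat q-prime q∤π))
  q∣σ[π^α]⇒n≡q² : q ∣ σ (π ^ α) → n ≡ q * q [mod 4 * (q * q) ]
  q∣σ[π^α]⇒n≡q² = π^α*M²≡q²[mod4q²] π α 2∤n n≡π^α*M² (≡[mod]⇒%≡ π 1 π≡1)
    ∘ q∣σ[π^α]⇒q∣M π α perfect n≡π^α*M² π-prime (coprime⇒prime∤ π-prime (gcd≡1⇒coprime gcd[π,M]≡1)) q-prime q∤2 q∤π
  q∣π∸1⇒π≡1 : q ∣ π ∸ 1 → π ≡ 1 [mod 4 * q ]
  q∣π∸1⇒π≡1 = ≡[mod]-coprime-* π 1 (prime∤⇒coprime q-prime ([ q∤2 , q∤2 ]′ ∘ euclidsLemma 2 2 q-prime)) π≡1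
    ∘ ∣∸⇒≡[mod] π 1 (>-nonZero⁻¹ π {{prime⇒nonZero π-prime}})
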